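{- For every integer $n\ge 3$, the graph $G_n$ satisfies $\rho(G_n)\le \left\lfloor \sqrt{2n-1}\right\rfloor+2$.
   Context: Rubbling: a pebble distribution on a graph $G$ is a function $p:V(G)\to\mathbb{Z}_{\ge0}$, of size $\sum_v p(v)$. The pebbling move $(v,v\to u)$ (for an edge $\{v,u\}$) removes two pebbles from $v$ and adds one at $u$; the strict rubbling move $(v,w\to u)$ (for $v\ne w$, both adjacent to $u$) removes one pebble from each of $v,w$ and adds one at $u$. A vertex is reachable from $p$ if some finite sequence of these moves, keeping all intermediate distributions nonnegative, puts at least one pebble on it. The rubbling number $\rho(G)$ is the least $m$ such that every vertex is reachable from every distribution of size $m$. Construction of $G_n$: For a positive integer $s$, let $H_s$ have vertex set $\{(i,j): 1\le i\le j\le s\}$, with $(i_1,j_1)$ and $(i_2,j_2)$ (distinct) adjacent iff $i_1=i_2$ or $j_1=j_2$. Let $H'_s$ be obtained from $H_s$ as follows: if $s$ is odd, delete the vertices $(2t,2t+1)$ for $1\le t\le (s-1)/2$ and add the edges $\{(2t+1,2t+1),(2t,2t)\}$ for $1\le t\le (s-1)/2$; if $s$ is even, delete the vertices $(2t-1,2t)$ for $2\le t\le s/2$ and add the edges $\{(2t,2t),(2t-1,2t-1)\}$ for $2\le t\le s/2$. Then $|V(H'_s)|=s(s+1)/2-\lfloor (s-1)/2\rfloor$. For $n\ge3$: if $n=|V(H'_s)|$ for some $s$, let $G_n=H'_s$. Otherwise $|V(H'_s)|<n<|V(H'_{s+1})|$ for a unique $s$, and $G_n$ is obtained from $H'_s$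 by adding the vertices $(0,s),(0,s-1),(0,s-2),\ldots$ one by one, in this order, until the graph has $n$ vertices; each new vertex $(0,j)$ is made adjacent to every other vertex $(i',j')$ present with $i'=0$ or $j'=j$. -}

module Defs where

open import Data.Nat using (ℕ; zero; suc; _+_; _*_; _∸_; _≤_; _<_; _≡ᵇ_; _≤ᵇ_)
open import Data.Nat.DivMod using (_/_; _%_)
open import Data.Bool using (Bool; true; false; if_then_else_; _∧_; _∨_; not; T)
open import Data.Fin using (Fin; _≟_)
open import Data.List using (List; []; _∷_; _++_; map; concatMap; filter; length; upTo; allFin; lookup)
open import Data.Nat.ListAction using (sum)
open import Data.Product using (_×_; _,_; proj₁; proj₂; ∃; ∃-syntax)
open import Data.Sum using (_⊎_)
open import Relation.Binary.PropositionalEquality using (_≡_; _≢_)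
open import Relation.Binary.Construct.Closure.ReflexiveTransitive using (Star)
open import Relation.Nullary.Decidable using (⌊_⌋)

-- Graphs on vertex set Fin N (simple graphs: adjacency is a relation;
-- loops are excluded where needed by requiring distinct endpoints).

record Graph : Set₁ where
  field
    N   : ℕ
    Adj : Fin N → Fin N → Set

Dist : ℕ → Set
Dist N = Fin N → ℕ

size : ∀ {N} → Dist N → ℕ
size {N} p = sum (map p (allFin N))

ind : ∀ {N} → Fin N → Fin N → ℕ
ind a x = if ⌊ a ≟ x ⌋ then 1 else 0

module _ (G : Graph) where
  open Graph G

  data Step (p : Dist N) : Dist N → Set where
    pebbling : (v u : Fin N) → Adj v u → 2 ≤ p v →
      Step p (λ x → (p x ∸ (ind v x + ind v x)) + ind u x)
    rubbling : (v w u : Fin N) → v ≢ w → Adj v u → Adj w u →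
      1 ≤ p v → 1 ≤ p w →
      Step p (λ x → (p x ∸ (ind v x + ind w x)) + ind u x)

  Reachable : Dist N → Fin N → Set
  Reachable p u = ∃[ q ] (Star Step p q × 1 ≤ q u)

  Solvable : ℕ → Set
  Solvable m = (p : Dist N) → size p ≡ m → (u : Fin N) → Reachable p u

  -- ρ(G) ≤ k, i.e. the least m with Solvable m exists and is ≤ k
  RubblingNumber≤ : ℕ → Set
  RubblingNumber≤ k = ∃[ m ] (m ≤ k × Solvable m)

Pair : Set
Pair = ℕ × ℕ

-- |V(H'_s)| = s(s+1)/2 - ⌊(s-1)/2⌋
hSize : ℕ → ℕ
hSize s = (s * suc s) / 2 ∸ (s ∸ 1) / 2

isOdd : ℕ → Bool
isOdd k = k % 2 ≡ᵇ 1

-- k is such that (k,k+1) is deleted and {(k,k),(k+1,k+1)} is added in H'_s: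
--  s odd : k = 2t,   1 ≤ t ≤ (s-1)/2
--  s even: k = 2t-1, 2 ≤ t ≤ s/2
special : ℕ → ℕ → Bool
special s k =
  if isOdd s
  then (not (isOdd k) ∧ (2 ≤ᵇ k) ∧ (k ≤ᵇ s ∸ 1))
  else (isOdd k ∧ (3 ≤ᵇ k) ∧ (k ≤ᵇ s ∸ 1))

deleted : ℕ → Pair → Bool
deleted s (i , j) = special s i ∧ (j ≡ᵇ suc i)

keep : ℕ → Pair → Bool
keep s v = not (deleted s v)

-- vertices of H_s: (i,j) with 1 ≤ i ≤ j ≤ s
hVerts : ℕ → List Pair
hVerts s = concatMap (λ i → map (λ j → (suc i , suc i + j)) (upTo (s ∸ i))) (upTo s)

h'Verts : ℕ → List Pair
h'Verts s = filter (λ v → T? (keep s v)) (hVerts s)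
  where
  open import Data.Bool.Properties using (T?)

-- vertices of G_n, where s satisfies |V(H'_s)| ≤ n < |V(H'_{s+1})|:
-- those of H'_s followed by (0,s),(0,s-1),... (n - |V(H'_s)| of them)
gVerts : ℕ → ℕ → List Pair
gVerts n s = h'Verts s ++ map (λ t → (0 , s ∸ t)) (upTo (n ∸ hSize s))

extraEdge : ℕ → Pair → Pair → Set
extraEdge s (a , b) (c , d) = T (special s a) × b ≡ a × c ≡ suc a × d ≡ suc a

-- adjacency on (distinct) pairs: same first or same second coordinate
-- (this covers H_s and the rule for the added vertices (0,j)),
-- or an added edge of H'_s (in either orientation)
AdjPair : ℕ → Pair → Pair → Set
AdjPair s x y = (proj₁ x ≡ proj₁ y ⊎ proj₂ x ≡ proj₂ y) ⊎ (extraEdge s x y ⊎ extraEdge s y x)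

G : ℕ → ℕ → Graph
G n s = record
  { N   = length (gVerts n s)
  ; Adj = λ x y → x ≢ y × AdjPair s (lookup (gVerts n s) x) (lookup (gVerts n s) y)
  }

-- Choose s as in the statement; then s ≤ ⌊√(2n−1)⌋, so it suffices that s + 2 pebbles reach any
-- target u of G_n. Vertices are pairs, adjacent (up to a few extra edges) when they share a row
-- or a column, and for u the labels 0, …, s name hubs, vertices adjacent to u, such that every
-- vertex is u, a neighbour of u or a neighbour of a hub, while two labels need no hub. With
-- s + 2 pebbles and none on u, either two pebbles lie on neighbours of u, or by pigeonhole over
-- the s − 1 hubs some hub has two pebbles next to it and a neighbour of u one, or a hub has four,
-- or two hubs have two each; then at most three pebbling or strict rubbling moves reach u.

module Submission where

open import Defs
open import Data.Bool using (true; false; not; T; if_then_else_) renaming (_≟_ to _≟ᴮ_)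
open import Data.Bool.Properties using (T?; T-≡; T-not-≡; T-∧; ¬-not; not-¬; not-involutive)
open import Data.Fin using (Fin; zero; suc; toℕ; fromℕ<; _≟_)
open import Data.Fin.Properties using (toℕ-fromℕ<; fromℕ<-injective)
import Data.Fin.Properties as Fin
open import Data.List using (List; map; tabulate; upTo; length; lookup)
open import Data.List.Membership.Propositional using (_∈_; find; lose)
open import Data.List.Membership.Propositional.Properties
open import Data.List.Relation.Unary.Any using (index)
open import Data.List.Relation.Unary.Any.Properties using (lookup-index)
open import Data.Nat using (ℕ; zero; suc; _+_; _*_; _∸_; _≤_; _<_; z≤n; s≤s; s≤s⁻¹; _≤?_; _<?_; _≡ᵇ_; _<ᵇ_)
  renaming (_≟_ to _≟ℕ_)
open import Data.Nat.DivMod using (_/_; m*n/n≡m; m/n≡1+[m∸n]/n; [m+kn]%n≡m%n)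
import Data.Nat.ListAction as ListAction
open import Data.Nat.Properties hiding (_≟_)
open import Algebra.Properties.CommutativeMonoid.Sum +-0-commutativeMonoid
  using (sum; ∑-distrib-+; ∑-comm; sum-cong-≗; sum-replicate-zero)
open import Data.Nat.Tactic.RingSolver using (solve-∀)
open import Data.Product using (_×_; _,_; proj₁; proj₂; Σ; ∃-syntax; Σ-syntax)
open import Data.Product.Properties using (≡-dec)
open import Data.List.Membership.DecPropositional (≡-dec _≟ℕ_ _≟ℕ_) using (_∈?_)
open import Data.Sum using (_⊎_; inj₁; inj₂; [_,_]′)
open import Data.Vec using (Vec; []; _∷_; _∷ʳ_) renaming (_++_ to _++ᵛ_)
open import Data.Vec.Relation.Unary.All as All using (All; []; _∷_)
open import Function using (_∘_; _∘′_; id; flip)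
open import Function.Bundles using (Equivalence)
open import Relation.Binary.Construct.Closure.ReflexiveTransitive using (Star; ε; _◅_; _◅◅_)
open import Relation.Binary.PropositionalEquality
open import Relation.Nullary using (¬_; yes; no; Dec; contradiction)
open import Relation.Nullary.Decidable using (⌊_⌋)

private
  variable
    n L : ℕ

-- Finite sums and a pigeonhole principle

_⊑_ : (f g : Fin n → ℕ) → Set
f ⊑ g = ∀ z → f z ≤ g z

⊑-trans : {f g h : Fin n → ℕ} → f ⊑ g → g ⊑ h → f ⊑ h
⊑-trans f⊑g g⊑h z = ≤-trans (f⊑g z) (g⊑h z)

∑-mono-≤ : {f g : Fin n → ℕ} → f ⊑ g → sum f ≤ sum g
∑-mono-≤ {zero}  f⊑g = z≤n
∑-mono-≤ {suc n} f⊑g = +-mono-≤ (f⊑g zero) (∑-mono-≤ (λ z → f⊑g (suc z)))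

∑-zero : (f : Fin n → ℕ) → (∀ z → f z ≡ 0) → sum f ≡ 0
∑-zero {n} f f≗0 = trans (sum-cong-≗ f≗0) (sum-replicate-zero n)

∑-one : sum {L} (λ _ → 1) ≡ L
∑-one {zero}  = refl
∑-one {suc L} = cong suc (∑-one {L})

term≤∑ : (f : Fin n → ℕ) (i : Fin n) → f i ≤ sum f
term≤∑ f zero    = m≤m+n (f zero) _
term≤∑ f (suc i) = ≤-trans (term≤∑ (λ z → f (suc z)) i) (m≤n+m _ (f zero))

positive-term : (f : Fin n → ℕ) → 1 ≤ sum f → ∃[ i ] 1 ≤ f i
positive-term {suc n} f h with f zero in eq
... | suc _ = zero , subst (1 ≤_) (sym eq) (s≤s z≤n)
... | zero  = let i , hi = positive-term (λ z → f (suc z)) h in suc i , hi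

spread : (f : Fin n → ℕ) → 3 ≤ sum f →
  (∃[ i ] 3 ≤ f i) ⊎ (∃[ i ] ∃[ j ] (i ≢ j × 1 ≤ f i × 1 ≤ f j))
spread {suc n} f h with f zero in eq
... | 0 with spread (λ z → f (suc z)) h
...   | inj₁ (i , hi) = inj₁ (suc i , hi)
...   | inj₂ (i , j , i≢j , hi , hj) = inj₂ (suc i , suc j , i≢j ∘′ Fin.suc-injective , hi , hj)
spread {suc n} f h | suc (suc (suc k)) = inj₁ (zero , subst (3 ≤_) (sym eq) (s≤s (s≤s (s≤s z≤n))))
spread {suc n} f h | 1 =
  let j , hj = positive-term (λ z → f (suc z)) (≤-trans (s≤s z≤n) (s≤s⁻¹ h))
  in inj₂ (zero , suc j , (λ ()) , subst (1 ≤_) (sym eq) (s≤s z≤n) , hj)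
spread {suc n} f h | 2 =
  let j , hj = positive-term (λ z → f (suc z)) (s≤s⁻¹ (s≤s⁻¹ h))
  in inj₂ (zero , suc j , (λ ()) , subst (1 ≤_) (sym eq) (s≤s z≤n) , hj)

ind-refl : (x : Fin n) → ind x x ≡ 1
ind-refl x with x ≟ x
... | yes _  = refl
... | no x≢x = contradiction refl x≢x

ind-suc : (e z : Fin n) → ind (suc e) (suc z) ≡ ind e z
ind-suc e z with e ≟ z
... | yes refl = refl
... | no _     = refl

∑-ind : (e : Fin n) → sum (ind e) ≡ 1
∑-ind {suc n} zero    = cong suc (∑-zero {n} (λ _ → 0) (λ _ → refl))
∑-ind {suc n} (suc e) = trans (sum-cong-≗ (ind-suc e)) (∑-ind e)

∑-minus-ind : (f : Fin n → ℕ) (x : Fin n) → 1 ≤ f x → sum f ≡ suc (sum (λ z → f z ∸ ind x z))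
∑-minus-ind f zero 1≤f₀ with f zero
... | suc _ = refl
∑-minus-ind f (suc x) 1≤fx = begin
  f zero + sum (λ z → f (suc z))
    ≡⟨ cong (f zero +_) (∑-minus-ind (λ z → f (suc z)) x 1≤fx) ⟩
  f zero + suc (sum (λ z → f (suc z) ∸ ind x z))
    ≡⟨ +-suc (f zero) _ ⟩
  suc (f zero + sum (λ z → f (suc z) ∸ ind x z))
    ≡⟨ cong (λ t → suc (f zero + t)) (sum-cong-≗ (λ z → cong (f (suc z) ∸_) (ind-suc x z))) ⟨
  suc (f zero + sum (λ z → f (suc z) ∸ ind (suc x) (suc z))) ∎
  where open ≡-Reasoning

ind≤ : (f : Fin n → ℕ) (x z : Fin n) → 1 ≤ f x → ind x z ≤ f z
ind≤ f x z 1≤fx with x ≟ z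
... | yes refl = 1≤fx
... | no _     = z≤n

size≡∑ : (p : Dist n) → size p ≡ sum p
size≡∑ p = go id
  where
  go : ∀ {m} (g : Fin m → Fin _) → ListAction.sum (map p (tabulate g)) ≡ sum (λ z → p (g z))
  go {zero}  g = refl
  go {suc m} g = cong (p (g zero) +_) (go (λ z → g (suc z)))

m≤n∸1⇒m<n : ∀ {m n} → 1 ≤ m → m ≤ n ∸ 1 → m < n
m≤n∸1⇒m<n {n = suc n} _       m≤n = s≤s m≤n
m≤n∸1⇒m<n {n = zero}  (s≤s _) ()

data Surplus (a : ℕ) (b : Fin L → ℕ) : Set where
  hub-and-neighbour : 1 ≤ a → ∀ ℓ → 2 ≤ b ℓ → Surplus a b
  one-hub           : ∀ ℓ → 4 ≤ b ℓ → Surplus a b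
  two-hubs          : ∀ ℓ ℓ′ → ℓ ≢ ℓ′ → 2 ≤ b ℓ → 2 ≤ b ℓ′ → Surplus a b

module _ {L} {e₁ e₂ : Fin L} (e₁≢e₂ : e₁ ≢ e₂) (b : Fin L → ℕ) (b₁ : b e₁ ≡ 0) (b₂ : b e₂ ≡ 0) where

  private
    excess-pointwise : ∀ ℓ → b ℓ + (ind e₁ ℓ + ind e₂ ℓ) ≤ 1 + (b ℓ ∸ 1)
    excess-pointwise ℓ with e₁ ≟ ℓ | e₂ ≟ ℓ
    ... | yes refl | yes refl = contradiction refl e₁≢e₂
    ... | yes refl | no _     rewrite b₁ = ≤-refl
    ... | no _     | yes refl rewrite b₂ = ≤-refl
    ... | no _     | no _     = ≤-trans (≤-reflexive (+-identityʳ (b ℓ))) (m≤n+m∸n (b ℓ) 1)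

  -- Each label carries at most one pebble plus its excess, the two unused labels nothing.
  excess-bound : sum b + 2 ≤ L + sum (λ ℓ → b ℓ ∸ 1)
  excess-bound = begin
    sum b + 2                                        ≡⟨ cong₂ (λ i j → sum b + (i + j)) (∑-ind e₁) (∑-ind e₂) ⟨
    sum b + (sum (ind e₁) + sum (ind e₂))            ≡⟨ cong (sum b +_) (∑-distrib-+ (ind e₁) (ind e₂)) ⟨
    sum b + sum (λ ℓ → ind e₁ ℓ + ind e₂ ℓ)          ≡⟨ ∑-distrib-+ b _ ⟨
    sum (λ ℓ → b ℓ + (ind e₁ ℓ + ind e₂ ℓ))          ≤⟨ ∑-mono-≤ excess-pointwise ⟩
    sum (λ ℓ → 1 + (b ℓ ∸ 1))                        ≡⟨ ∑-distrib-+ {L} (λ _ → 1) _ ⟩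
    sum {L} (λ _ → 1) + sum (λ ℓ → b ℓ ∸ 1)          ≡⟨ cong (_+ sum (λ ℓ → b ℓ ∸ 1)) ∑-one ⟩
    L + sum (λ ℓ → b ℓ ∸ 1)                          ∎
    where open ≤-Reasoning

  private
    excess≥ : ∀ k → L + k ≤ sum b + 2 → k ≤ sum (λ ℓ → b ℓ ∸ 1)
    excess≥ k h = +-cancelˡ-≤ L k _ (≤-trans h excess-bound)

  surplus : ∀ a → a ≤ 1 → suc L ≤ a + sum b → Surplus a b
  surplus 1 _ h =
    let ℓ , hℓ = positive-term _ (≤-trans (s≤s z≤n) (excess≥ 2 (+-monoˡ-≤ 2 (s≤s⁻¹ h))))
    in hub-and-neighbour (s≤s z≤n) ℓ (m≤n∸1⇒m<n (s≤s z≤n) hℓ)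
  surplus 0 _ h with spread _ (excess≥ 3 (≤-trans (≤-reflexive (+-suc L 2)) (+-monoˡ-≤ 2 h)))
  ... | inj₁ (ℓ , hℓ) = one-hub ℓ (m≤n∸1⇒m<n (s≤s z≤n) hℓ)
  ... | inj₂ (ℓ , ℓ′ , ℓ≢ℓ′ , hℓ , hℓ′) =
    two-hubs ℓ ℓ′ ℓ≢ℓ′ (m≤n∸1⇒m<n (s≤s z≤n) hℓ) (m≤n∸1⇒m<n (s≤s z≤n) hℓ′)
  surplus (suc (suc _)) (s≤s ()) _

-- Rubbling towards a target through hubs

pebbles : ∀ {k} → Vec (Fin n) k → Dist n
pebbles []       z = 0
pebbles (x ∷ xs) z = ind x z + pebbles xs z

pebbles-++ : ∀ {k l} (xs : Vec (Fin n) k) (ys : Vec (Fin n) l) (z : Fin n) →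
  pebbles (xs ++ᵛ ys) z ≡ pebbles xs z + pebbles ys z
pebbles-++ []       ys z = refl
pebbles-++ (x ∷ xs) ys z = trans (cong (ind x z +_) (pebbles-++ xs ys z)) (sym (+-assoc (ind x z) _ _))

pebbles-∷ʳ : ∀ {k} (xs : Vec (Fin n) k) (w z : Fin n) → pebbles (xs ∷ʳ w) z ≡ pebbles xs z + ind w z
pebbles-∷ʳ []       w z = +-identityʳ (ind w z)
pebbles-∷ʳ (x ∷ xs) w z = trans (cong (ind x z +_) (pebbles-∷ʳ xs w z)) (sym (+-assoc (ind x z) _ _))

pick : (f : Fin n → ℕ) (k : ℕ) → k ≤ sum f → Σ[ xs ∈ Vec (Fin n) k ] pebbles xs ⊑ f
pick f zero    _ = [] , λ _ → z≤n
pick f (suc k) h =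
  let x , 1≤fx = positive-term f (≤-trans (s≤s z≤n) h)
      xs , xs⊑  = pick (λ z → f z ∸ ind x z) k (s≤s⁻¹ (≤-trans h (≤-reflexive (∑-minus-ind f x 1≤fx))))
  in x ∷ xs , λ z →
       ≤-trans (+-monoʳ-≤ (ind x z) (xs⊑ z)) (≤-reflexive (m+[n∸m]≡n (ind≤ f x z 1≤fx)))

pebbles⊑⇒positive : ∀ {k} {f : Fin n → ℕ} (xs : Vec (Fin n) k) → pebbles xs ⊑ f → All (λ x → 1 ≤ f x) xs
pebbles⊑⇒positive []       _  = []
pebbles⊑⇒positive (x ∷ xs) ⊑f =
  ≤-trans (≤-trans (≤-reflexive (sym (ind-refl x))) (m≤m+n _ _)) (⊑f x) ∷
  pebbles⊑⇒positive xs (λ z → ≤-trans (m≤n+m _ _) (⊑f z))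

data Role (L : ℕ) : Set where
  target neighbour : Role L
  near             : Fin L → Role L

_≟ᴿ_ : (r r′ : Role L) → Dec (r ≡ r′)
target    ≟ᴿ target     = yes refl
neighbour ≟ᴿ neighbour  = yes refl
near ℓ    ≟ᴿ near ℓ′    with ℓ ≟ ℓ′
... | yes refl = yes refl
... | no ℓ≢ℓ′  = no λ { refl → ℓ≢ℓ′ refl }
target    ≟ᴿ neighbour  = no λ ()
target    ≟ᴿ near _     = no λ ()
neighbour ≟ᴿ target     = no λ ()
neighbour ≟ᴿ near _     = no λ ()
near _    ≟ᴿ target     = no λ ()
near _    ≟ᴿ neighbour  = no λ ()

module Rubbling (G : Graph) where
  open Graph G

  _⟶*_ : Dist N → Dist N → Set
  _⟶*_ = Star (Step G)

  -- The new pebble on w is queued last, so chained gathers consume the remaining pairs in order.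
  gather : ∀ {k} {p : Dist N} {x y w : Fin N} (xs : Vec (Fin N) k) → Adj x w → Adj y w →
    pebbles (x ∷ y ∷ xs) ⊑ p → ∃[ q ] (p ⟶* q × pebbles (xs ∷ʳ w) ⊑ q)
  gather {p = p} {x} {y} {w} xs x~w y~w h = _ , move ◅ ε , bound
    where
    move : Step G p (λ z → (p z ∸ (ind x z + ind y z)) + ind w z)
    move with x ≟ y | pebbles⊑⇒positive (x ∷ y ∷ xs) h
    ... | yes refl | _ = pebbling x w x~w
      (≤-trans (m≤m+n 2 _) (subst (λ t → t + (t + pebbles xs x) ≤ p x) (ind-refl x) (h x)))
    ... | no x≢y | 1≤px ∷ 1≤py ∷ _ = rubbling x y w x≢y x~w y~w 1≤px 1≤py
    bound : pebbles (xs ∷ʳ w) ⊑ (λ z → (p z ∸ (ind x z + ind y z)) + ind w z)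
    bound z = begin
      pebbles (xs ∷ʳ w) z                ≡⟨ pebbles-∷ʳ xs w z ⟩
      pebbles xs z + ind w z             ≤⟨ +-monoˡ-≤ (ind w z) (m+n≤o⇒m≤o∸n (pebbles xs z)
                                             (≤-trans (≤-reflexive (trans (+-comm (pebbles xs z) _) (+-assoc (ind x z) _ _)))
                                                      (h z))) ⟩
      (p z ∸ (ind x z + ind y z)) + ind w z ∎
      where open ≤-Reasoning

  _◅◅ʳ_ : ∀ {p q u} → p ⟶* q → Reachable G q u → Reachable G p u
  p⟶q ◅◅ʳ (r , q⟶r , 1≤ru) = r , p⟶q ◅◅ q⟶r , 1≤ru

  reach-directly : ∀ {p x y u} → Adj x u → Adj y u → pebbles (x ∷ y ∷ []) ⊑ p → Reachable G p u
  reach-directly {u = u} x~u y~u h =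
    let q , p⟶q , ⊑q = gather [] x~u y~u h
    in q , p⟶q , ≤-trans (≤-reflexive (sym (cong (_+ 0) (ind-refl u)))) (⊑q u)

  reach-via-hub : ∀ {p x y v w u} → Adj x w → Adj y w → Adj w u → Adj v u →
    pebbles (x ∷ y ∷ v ∷ []) ⊑ p → Reachable G p u
  reach-via-hub {v = v} x~w y~w w~u v~u h =
    let q , p⟶q , ⊑q = gather (v ∷ []) x~w y~w h
    in p⟶q ◅◅ʳ reach-directly v~u w~u ⊑q

  reach-via-hubs : ∀ {p x₁ y₁ x₂ y₂ w₁ w₂ u} → Adj x₁ w₁ → Adj y₁ w₁ → Adj x₂ w₂ → Adj y₂ w₂ →
    Adj w₁ u → Adj w₂ u → pebbles (x₁ ∷ y₁ ∷ x₂ ∷ y₂ ∷ []) ⊑ p → Reachable G p u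
  reach-via-hubs {x₂ = x₂} {y₂} x₁~w₁ y₁~w₁ x₂~w₂ y₂~w₂ w₁~u w₂~u h =
    let q , p⟶q , ⊑q = gather (x₂ ∷ y₂ ∷ []) x₁~w₁ y₁~w₁ h
    in p⟶q ◅◅ʳ reach-via-hub x₂~w₂ y₂~w₂ w₂~u w₁~u ⊑q

  Fits : ∀ {L} (u : Fin N) (hub : Fin L → Fin N) (unused₁ unused₂ : Fin L) → Role L → Fin N → Set
  Fits u hub unused₁ unused₂ target    v = v ≡ u
  Fits u hub unused₁ unused₂ neighbour v = Adj v u
  Fits u hub unused₁ unused₂ (near ℓ)  v = ℓ ≢ unused₁ × ℓ ≢ unused₂ × Adj v (hub ℓ) × Adj (hub ℓ) u

  record HubCover (u : Fin N) (L : ℕ) : Set where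
    field
      hub             : Fin L → Fin N
      unused₁ unused₂ : Fin L
      unused₁≢unused₂ : unused₁ ≢ unused₂
      role            : Fin N → Role L
      fits            : ∀ v → Fits u hub unused₁ unused₂ (role v) v

  module _ {u : Fin N} {L : ℕ} (C : HubCover u L) where
    open HubCover C

    private
      Fits′ : Role L → Fin N → Set
      Fits′ = Fits u hub unused₁ unused₂

      _↾_ : Dist N → Role L → Dist N
      (p ↾ r) z = if ⌊ role z ≟ᴿ r ⌋ then p z else 0

      ↾-self : ∀ p {r} z → role z ≡ r → (p ↾ r) z ≡ p z
      ↾-self p {r} z eq with role z ≟ᴿ r
      ... | yes _  = refl
      ... | no ≢r = contradiction eq ≢r

      ↾-⊑ : ∀ p r → (p ↾ r) ⊑ p
      ↾-⊑ p r z with role z ≟ᴿ r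
      ... | yes _ = ≤-refl
      ... | no _  = z≤n

      ↾-fits : ∀ p r z → 1 ≤ (p ↾ r) z → Fits′ r z
      ↾-fits p r z h with role z ≟ᴿ r | fits z
      ... | yes refl | fz = fz
      ... | no _     | _  = contradiction h λ ()

      ↾-disjoint : ∀ p {r r′} → r ≢ r′ → (λ z → (p ↾ r) z + (p ↾ r′) z) ⊑ p
      ↾-disjoint p {r} {r′} r≢r′ z with role z ≟ᴿ r | role z ≟ᴿ r′
      ... | yes refl | yes refl = contradiction refl r≢r′
      ... | yes _    | no _     = ≤-reflexive (+-identityʳ (p z))
      ... | no _     | yes _    = ≤-refl
      ... | no _     | no _     = z≤n

      ↾-unused : ∀ p {e} → e ≡ unused₁ ⊎ e ≡ unused₂ → sum (p ↾ near e) ≡ 0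
      ↾-unused p {e} e-unused = ∑-zero _ vanishes
        where
        vanishes : ∀ z → (p ↾ near e) z ≡ 0
        vanishes z with (p ↾ near e) z | ↾-fits p (near e) z
        ... | zero  | _  = refl
        ... | suc _ | fz with fz (s≤s z≤n)
        ...   | e≢unused₁ , e≢unused₂ , _ =
          [ flip contradiction e≢unused₁ , flip contradiction e≢unused₂ ]′ e-unused

      ↾-split : ∀ p z → p z ≤ (p ↾ target) z + ((p ↾ neighbour) z + sum (λ ℓ → (p ↾ near ℓ) z))
      ↾-split p z = ≤-trans (≤-reflexive (sym (↾-self p z refl))) (bound (role z))
        where
        bound : ∀ r → (p ↾ r) z ≤ (p ↾ target) z + ((p ↾ neighbour) z + sum (λ ℓ → (p ↾ near ℓ) z))
        bound target    = m≤m+n _ _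
        bound neighbour = ≤-trans (m≤m+n _ _) (m≤n+m _ ((p ↾ target) z))
        bound (near ℓ)  = ≤-trans (term≤∑ (λ ℓ′ → (p ↾ near ℓ′) z) ℓ)
                            (≤-trans (m≤n+m _ ((p ↾ neighbour) z)) (m≤n+m _ ((p ↾ target) z)))

      a₀ a₁ : Dist N → ℕ
      a₀ p = sum (p ↾ target)
      a₁ p = sum (p ↾ neighbour)

      b : Dist N → Fin L → ℕ
      b p ℓ = sum (p ↾ near ℓ)

      count : ∀ p → size p ≤ a₀ p + (a₁ p + sum (b p))
      count p = begin
        size p                                                  ≡⟨ size≡∑ p ⟩
        sum p                                                   ≤⟨ ∑-mono-≤ (↾-split p) ⟩
        sum (λ z → (p ↾ target) z + ((p ↾ neighbour) z + sum (λ ℓ → (p ↾ near ℓ) z)))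
                                                                ≡⟨ ∑-distrib-+ (p ↾ target) _ ⟩
        sum (p ↾ target) + sum (λ z → (p ↾ neighbour) z + sum (λ ℓ → (p ↾ near ℓ) z))
                                                                ≡⟨ cong (sum (p ↾ target) +_) (∑-distrib-+ (p ↾ neighbour) _) ⟩
        sum (p ↾ target) + (sum (p ↾ neighbour) + sum (λ z → sum (λ ℓ → (p ↾ near ℓ) z)))
                                                                ≡⟨ cong (λ t → sum (p ↾ target) + (sum (p ↾ neighbour) + t))
                                                                        (∑-comm (λ z ℓ → (p ↾ near ℓ) z)) ⟩
        sum (p ↾ target) + (sum (p ↾ neighbour) + sum (λ ℓ → sum (p ↾ near ℓ))) ∎
        where open ≤-Reasoning

      Picked : Dist N → Role L → ℕ → Set
      Picked p r k = Σ[ xs ∈ Vec (Fin N) k ] (pebbles xs ⊑ (p ↾ r) × All (Fits′ r) xs)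

      pick-role : ∀ p r k → k ≤ sum (p ↾ r) → Picked p r k
      pick-role p r k h =
        let xs , xs⊑ = pick (p ↾ r) k h
        in xs , xs⊑ , All.map (λ {z} → ↾-fits p r z) (pebbles⊑⇒positive xs xs⊑)

      combine : ∀ p {r r′ k l} (xs : Vec (Fin N) k) (ys : Vec (Fin N) l) → r ≢ r′ →
                pebbles xs ⊑ (p ↾ r) → pebbles ys ⊑ (p ↾ r′) → pebbles (xs ++ᵛ ys) ⊑ p
      combine p xs ys r≢r′ ⊑r ⊑r′ z =
        ≤-trans (≤-reflexive (pebbles-++ xs ys z)) (≤-trans (+-mono-≤ (⊑r z) (⊑r′ z)) (↾-disjoint p r≢r′ z))

      reach-from-target : ∀ p → Picked p target 1 → Reachable G p u
      reach-from-target p (x ∷ [] , x⊑ , refl ∷ []) =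
        p , ε , ≤-trans (All.head (pebbles⊑⇒positive (x ∷ []) x⊑)) (↾-⊑ p target x)

      reach-from-neighbours : ∀ p → Picked p neighbour 2 → Reachable G p u
      reach-from-neighbours p (x ∷ y ∷ [] , xy⊑ , x~u ∷ y~u ∷ []) =
        reach-directly x~u y~u (⊑-trans xy⊑ (↾-⊑ p neighbour))

      reach-from-hub-and-neighbour : ∀ p ℓ → Picked p (near ℓ) 2 → Picked p neighbour 1 → Reachable G p u
      reach-from-hub-and-neighbour p ℓ (x ∷ y ∷ [] , xy⊑ , (_ , _ , x~w , w~u) ∷ (_ , _ , y~w , _) ∷ [])
                                       (v ∷ [] , v⊑ , v~u ∷ []) =
        reach-via-hub x~w y~w w~u v~u (combine p (x ∷ y ∷ []) (v ∷ []) (λ ()) xy⊑ v⊑)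

      reach-from-one-hub : ∀ p ℓ → Picked p (near ℓ) 4 → Reachable G p u
      reach-from-one-hub p ℓ (x₁ ∷ y₁ ∷ x₂ ∷ y₂ ∷ [] , xs⊑ ,
                              (_ , _ , x₁~w , w~u) ∷ (_ , _ , y₁~w , _) ∷ (_ , _ , x₂~w , _) ∷ (_ , _ , y₂~w , _) ∷ []) =
        reach-via-hubs x₁~w y₁~w x₂~w y₂~w w~u w~u (⊑-trans xs⊑ (↾-⊑ p (near ℓ)))

      reach-from-two-hubs : ∀ p {ℓ ℓ′} → ℓ ≢ ℓ′ → Picked p (near ℓ) 2 → Picked p (near ℓ′) 2 → Reachable G p u
      reach-from-two-hubs p ℓ≢ℓ′ (x₁ ∷ y₁ ∷ [] , xs⊑ , (_ , _ , x₁~w₁ , w₁~u) ∷ (_ , _ , y₁~w₁ , _) ∷ [])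
                                 (x₂ ∷ y₂ ∷ [] , ys⊑ , (_ , _ , x₂~w₂ , w₂~u) ∷ (_ , _ , y₂~w₂ , _) ∷ []) =
        reach-via-hubs x₁~w₁ y₁~w₁ x₂~w₂ y₂~w₂ w₁~u w₂~u
          (combine p (x₁ ∷ y₁ ∷ []) (x₂ ∷ y₂ ∷ []) (λ { refl → ℓ≢ℓ′ refl }) xs⊑ ys⊑)

      reach-from-surplus : ∀ p → Surplus (a₁ p) (b p) → Reachable G p u
      reach-from-surplus p (hub-and-neighbour 1≤a₁ ℓ 2≤bℓ) =
        reach-from-hub-and-neighbour p ℓ (pick-role p (near ℓ) 2 2≤bℓ) (pick-role p neighbour 1 1≤a₁)
      reach-from-surplus p (one-hub ℓ 4≤bℓ) = reach-from-one-hub p ℓ (pick-role p (near ℓ) 4 4≤bℓ)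
      reach-from-surplus p (two-hubs ℓ ℓ′ ℓ≢ℓ′ 2≤bℓ 2≤bℓ′) =
        reach-from-two-hubs p ℓ≢ℓ′ (pick-role p (near ℓ) 2 2≤bℓ) (pick-role p (near ℓ′) 2 2≤bℓ′)

    hubCover⇒reachable : ∀ p → suc L ≤ size p → Reachable G p u
    hubCover⇒reachable p L<size with 1 ≤? a₀ p | 2 ≤? a₁ p
    ... | yes 1≤a₀ | _        = reach-from-target p (pick-role p target 1 1≤a₀)
    ... | no _     | yes 2≤a₁ = reach-from-neighbours p (pick-role p neighbour 2 2≤a₁)
    ... | no a₀≱1  | no a₁≱2  = reach-from-surplus p
      (surplus unused₁≢unused₂ (b p) (↾-unused p (inj₁ refl)) (↾-unused p (inj₂ refl)) (a₁ p) a₁≤1 L<a₁+∑b)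
      where
      a₁≤1 : a₁ p ≤ 1
      a₁≤1 = s≤s⁻¹ (≰⇒> a₁≱2)
      L<a₁+∑b : suc L ≤ a₁ p + sum (b p)
      L<a₁+∑b = ≤-trans L<size (≤-trans (count p)
                  (≤-reflexive (cong (_+ (a₁ p + sum (b p))) (n≤0⇒n≡0 (s≤s⁻¹ (≰⇒> a₀≱1))))))

  hubCovers⇒solvable : ∀ {L m} → (∀ u → HubCover u L) → suc L ≤ m → Solvable G m
  hubCovers⇒solvable {L} cover L<m p size≡m u = hubCover⇒reachable (cover u) p (subst (suc L ≤_) (sym size≡m) L<m)

-- The vertices of G_n

-- The n ∸ hSize s added vertices are the (0 , j) with s − j < n ∸ hSize s.
data IsVertex (n s : ℕ) : Pair → Set where
  added : ∀ {j} → j ≤ s → s < j + (n ∸ hSize s) → IsVertex n s (0 , j)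
  kept  : ∀ {i j} → 1 ≤ i → i ≤ j → j ≤ s → deleted s (i , j) ≡ false → IsVertex n s (i , j)

private
  hRow : ℕ → ℕ → List Pair
  hRow s i = map (λ j → (suc i , suc i + j)) (upTo (s ∸ i))

∈hVerts⇒ : ∀ {s i j} → (i , j) ∈ hVerts s → 1 ≤ i × i ≤ j × j ≤ s
∈hVerts⇒ {s} mem with find (∈-concatMap⁻ (hRow s) {xs = upTo s} mem)
... | i , i∈ , ij∈ with ∈-map⁻ (λ j → (suc i , suc i + j)) ij∈
...   | j , j∈ , refl = s≤s z≤n , m≤m+n (suc i) j , j≤s
  where
  j≤s : suc i + j ≤ s
  j≤s = begin
    suc i + j         ≡⟨ +-suc i j ⟨
    i + suc j         ≤⟨ +-monoʳ-≤ i (∈-upTo⁻ j∈) ⟩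
    i + (s ∸ i)       ≡⟨ m+[n∸m]≡n (<⇒≤ (∈-upTo⁻ i∈)) ⟩
    s                 ∎
    where open ≤-Reasoning

⇒∈hVerts : ∀ {s i j} → 1 ≤ i → i ≤ j → j ≤ s → (i , j) ∈ hVerts s
⇒∈hVerts {s} {suc i} {j} _ i<j j≤s =
  ∈-concatMap⁺ (hRow s) {xs = upTo s} (lose (∈-upTo⁺ i<s) (subst (λ k → (suc i , k) ∈ hRow s i) (m+[n∸m]≡n i<j)
    (∈-map⁺ (λ k → (suc i , suc i + k)) (∈-upTo⁺ j∸i<s∸i))))
  where
  i<s : i < s
  i<s = ≤-trans i<j j≤s
  j∸i<s∸i : j ∸ suc i < s ∸ i
  j∸i<s∸i = +-cancelˡ-< i (j ∸ suc i) (s ∸ i) (begin-strict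
    i + (j ∸ suc i)       <⟨ n<1+n _ ⟩
    suc i + (j ∸ suc i)   ≡⟨ m+[n∸m]≡n i<j ⟩
    j                     ≤⟨ j≤s ⟩
    s                     ≡⟨ m+[n∸m]≡n (<⇒≤ i<s) ⟨
    i + (s ∸ i)           ∎)
    where open ≤-Reasoning

IsVertex⇒∈gVerts : ∀ {n s x} → IsVertex n s x → x ∈ gVerts n s
IsVertex⇒∈gVerts {n} {s} (kept 1≤i i≤j j≤s undeleted) =
  ∈-++⁺ˡ (∈-filter⁺ (λ v → T? (keep s v)) (⇒∈hVerts 1≤i i≤j j≤s) (Equivalence.from T-not-≡ undeleted))
IsVertex⇒∈gVerts {n} {s} (added {j} j≤s s<j+c) = ∈-++⁺ʳ (h'Verts s)
  (subst (λ k → (0 , k) ∈ map (λ t → (0 , s ∸ t)) (upTo (n ∸ hSize s))) (m∸[m∸n]≡n j≤s)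
    (∈-map⁺ (λ t → (0 , s ∸ t)) (∈-upTo⁺ (+-cancelʳ-< j (s ∸ j) (n ∸ hSize s) (begin-strict
      s ∸ j + j                 ≡⟨ m∸n+n≡m j≤s ⟩
      s                         <⟨ s<j+c ⟩
      j + (n ∸ hSize s)         ≡⟨ +-comm j _ ⟩
      (n ∸ hSize s) + j         ∎)))))
  where open ≤-Reasoning

∈gVerts⇒IsVertex : ∀ {n s x} → x ∈ gVerts n s → IsVertex n s x
∈gVerts⇒IsVertex {n} {s} {x} mem with ∈-++⁻ (h'Verts s) mem
... | inj₁ mem′ with ∈-filter⁻ (λ v → T? (keep s v)) {xs = hVerts s} mem′
...   | mem″ , kept′ with ∈hVerts⇒ mem″
...     | 1≤i , i≤j , j≤s = kept 1≤i i≤j j≤s (Equivalence.to T-not-≡ kept′)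
∈gVerts⇒IsVertex {n} {s} mem | inj₂ mem′ with ∈-map⁻ (λ t → (0 , s ∸ t)) mem′
... | t , t∈ , refl = added (m∸n≤m s t) (begin-strict
  s                          ≤⟨ m≤n+m∸n s t ⟩
  t + (s ∸ t)                ≡⟨ +-comm t _ ⟩
  (s ∸ t) + t                <⟨ +-monoʳ-< (s ∸ t) (∈-upTo⁻ t∈) ⟩
  (s ∸ t) + (n ∸ hSize s)    ∎)
  where open ≤-Reasoning

vertex : ∀ {n s} (v : Fin (length (gVerts n s))) → IsVertex n s (lookup (gVerts n s) v)
vertex v = ∈gVerts⇒IsVertex (∈-lookup v)

-- Parity and the sizes of H'_s

data Parity : ℕ → Set where
  even : ∀ k → Parity (k * 2)
  odd  : ∀ k → Parity (suc (k * 2))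

parity : ∀ m → Parity m
parity zero = even 0
parity (suc m) with parity m
... | even k = odd k
... | odd k  = even (suc k)

isOdd-even : ∀ k → isOdd (k * 2) ≡ false
isOdd-even k = cong (_≡ᵇ 1) ([m+kn]%n≡m%n 0 k 2)

isOdd-odd : ∀ k → isOdd (suc (k * 2)) ≡ true
isOdd-odd k = cong (_≡ᵇ 1) ([m+kn]%n≡m%n 1 k 2)

isOdd-suc : ∀ m → isOdd (suc m) ≡ not (isOdd m)
isOdd-suc m with parity m
... | even k = trans (isOdd-odd k) (cong not (sym (isOdd-even k)))
... | odd k  = trans (isOdd-even (suc k)) (cong not (sym (isOdd-odd k)))

hSize-odd : ∀ k → hSize (suc (k * 2)) ≡ suc (k * k * 2 + k * 2)
hSize-odd k = begin
  (suc (k * 2) * suc (suc (k * 2))) / 2 ∸ (k * 2) / 2    ≡⟨ cong (λ a → a / 2 ∸ (k * 2) / 2) (lemma₁ k) ⟩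
  (suc (k * 2) * suc k * 2) / 2 ∸ (k * 2) / 2            ≡⟨ cong₂ _∸_ (m*n/n≡m (suc (k * 2) * suc k) 2) (m*n/n≡m k 2) ⟩
  suc (k * 2) * suc k ∸ k                                ≡⟨ cong (_∸ k) (lemma₂ k) ⟩
  suc (k * k * 2 + k * 2) + k ∸ k                        ≡⟨ m+n∸n≡m _ k ⟩
  suc (k * k * 2 + k * 2)                                ∎
  where
  open ≡-Reasoning
  lemma₁ : ∀ k → suc (k * 2) * suc (suc (k * 2)) ≡ suc (k * 2) * suc k * 2
  lemma₁ = solve-∀
  lemma₂ : ∀ k → suc (k * 2) * suc k ≡ suc (k * k * 2 + k * 2) + k
  lemma₂ = solve-∀

hSize-even : ∀ k → hSize (suc k * 2) ≡ suc (suc k * suc k * 2)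
hSize-even k = begin
  (suc k * 2 * suc (suc k * 2)) / 2 ∸ suc (k * 2) / 2    ≡⟨ cong₂ _∸_ (cong (_/ 2) (lemma₁ k)) (odd/2 k) ⟩
  (suc k * suc (suc k * 2) * 2) / 2 ∸ k                  ≡⟨ cong (_∸ k) (m*n/n≡m (suc k * suc (suc k * 2)) 2) ⟩
  suc k * suc (suc k * 2) ∸ k                            ≡⟨ cong (_∸ k) (lemma₂ k) ⟩
  suc (suc k * suc k * 2) + k ∸ k                        ≡⟨ m+n∸n≡m _ k ⟩
  suc (suc k * suc k * 2)                                ∎
  where
  open ≡-Reasoning
  odd/2 : ∀ k → suc (k * 2) / 2 ≡ k
  odd/2 zero    = refl
  odd/2 (suc k) = trans (m/n≡1+[m∸n]/n {suc (suc (suc (k * 2)))} {2} (s≤s (s≤s z≤n))) (cong suc (odd/2 k))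
  lemma₁ : ∀ k → suc k * 2 * suc (suc k * 2) ≡ suc k * suc (suc k * 2) * 2
  lemma₁ = solve-∀
  lemma₂ : ∀ k → suc k * suc (suc k * 2) ≡ suc (suc k * suc k * 2) + k
  lemma₂ = solve-∀

square<2*hSize : ∀ s → 1 ≤ s → s * s < 2 * hSize s
square<2*hSize s 1≤s with parity s
... | odd k = ≤-reflexive (trans (lemma k) (cong (2 *_) (sym (hSize-odd k))))
  where
  lemma : ∀ k → suc (suc (k * 2) * suc (k * 2)) ≡ 2 * suc (k * k * 2 + k * 2)
  lemma = solve-∀
... | even (suc k) = ≤-trans (n≤1+n _) (≤-reflexive (trans (lemma k) (cong (2 *_) (sym (hSize-even k)))))
  where
  lemma : ∀ k → suc (suc (suc k * 2 * (suc k * 2))) ≡ 2 * suc (suc k * suc k * 2)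
  lemma = solve-∀

hSize-step-odd : ∀ k → hSize (suc (suc (k * 2))) ≡ hSize (suc (k * 2)) + suc (suc (k * 2))
hSize-step-odd k = trans (hSize-even k) (trans (lemma k) (cong (_+ suc (suc (k * 2))) (sym (hSize-odd k))))
  where
  lemma : ∀ k → suc (suc k * suc k * 2) ≡ suc (k * k * 2 + k * 2) + suc (suc (k * 2))
  lemma = solve-∀

hSize-step-even : ∀ k → hSize (suc (suc k * 2)) ≡ hSize (suc k * 2) + suc k * 2
hSize-step-even k = trans (hSize-odd (suc k)) (trans (lemma k) (cong (_+ suc k * 2) (sym (hSize-even k))))
  where
  lemma : ∀ k → suc (suc k * suc k * 2 + suc k * 2) ≡ suc (suc k * suc k * 2) + suc k * 2
  lemma = solve-∀

added-count : ∀ {n s} → n < hSize (suc s) → n ∸ hSize s ≤ s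
added-count {n} {s} n<h with parity s
... | odd k        = s≤s⁻¹ (m<n+o⇒m∸n<o n (hSize s) (subst (n <_) (hSize-step-odd k) n<h))
... | even zero    = s≤s⁻¹ n<h
... | even (suc k) = <⇒≤ (m<n+o⇒m∸n<o n (hSize s) (subst (n <_) (hSize-step-even k) n<h))

added-count-even : ∀ {n s} → n < hSize (suc s) → 1 ≤ s → isOdd s ≡ false → n ∸ hSize s < s
added-count-even {n} {s} n<h 1≤s with parity s
... | even (suc k) = λ _ → m<n+o⇒m∸n<o n (hSize s) (subst (n <_) (hSize-step-even k) n<h)
... | odd k        = λ even≡ → contradiction (trans (sym even≡) (isOdd-odd k)) λ ()

-- Special labels and deleted vertices

<ᵇ-true : ∀ {m k} → m < k → (m <ᵇ k) ≡ true
<ᵇ-true m<k = Equivalence.to T-≡ (<⇒<ᵇ m<k)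

<ᵇ-false : ∀ {m k} → ¬ m < k → (m <ᵇ k) ≡ false
<ᵇ-false {m} {k} m≮k = ¬-not λ eq → m≮k (<ᵇ⇒< m k (Equivalence.from T-≡ eq))

special-intro : ∀ {s k} → isOdd k ≢ isOdd s → 2 ≤ k → (isOdd s ≡ false → 3 ≤ k) → suc k ≤ s → T (special s k)
special-intro {suc s} {k} k≢s 2≤k 3≤k (s≤s k≤s) with isOdd (suc s) | isOdd k
... | true  | true  = contradiction refl k≢s
... | true  | false = Equivalence.from T-∧ (≤⇒≤ᵇ 2≤k , ≤⇒≤ᵇ k≤s)
... | false | true  = Equivalence.from T-∧ (≤⇒≤ᵇ (3≤k refl) , ≤⇒≤ᵇ k≤s)
... | false | false = contradiction refl k≢s

special-elim : ∀ {s k} → T (special s k) → isOdd k ≢ isOdd s × 2 ≤ k × suc k ≤ s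
special-elim {s} {k} sp with isOdd s | isOdd k
... | true  | false = let 2≤k , k≤s∸1 = Equivalence.to T-∧ sp
                          2≤k′ = ≤ᵇ⇒≤ 2 k 2≤k
                      in (λ ()) , 2≤k′ , m≤n∸1⇒m<n (≤-trans (s≤s z≤n) 2≤k′) (≤ᵇ⇒≤ k (s ∸ 1) k≤s∸1)
... | false | true  = let 3≤k , k≤s∸1 = Equivalence.to T-∧ sp
                          2≤k′ = ≤-trans (n≤1+n 2) (≤ᵇ⇒≤ 3 k 3≤k)
                      in (λ ()) , 2≤k′ , m≤n∸1⇒m<n (≤-trans (s≤s z≤n) 2≤k′) (≤ᵇ⇒≤ k (s ∸ 1) k≤s∸1)

special-not-consecutive : ∀ {s k} → T (special s k) → ¬ T (special s (suc k))
special-not-consecutive {s} {k} sp sp′ =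
  let k≢s , _ = special-elim {s} {k} sp
      k+1≢s , _ = special-elim {s} {suc k} sp′
  in k+1≢s (trans (isOdd-suc k) (trans (cong not (¬-not k≢s)) (not-involutive (isOdd s))))

undeleted : ∀ {s i j} → (T (special s i) → j ≢ suc i) → deleted s (i , j) ≡ false
undeleted {s} {i} {j} h with special s i | j ≡ᵇ suc i in eq
... | false | _     = refl
... | true  | false = refl
... | true  | true  = contradiction (≡ᵇ⇒≡ j (suc i) (subst T (sym eq) _)) (h _)

deleted-diagonal : ∀ s k → deleted s (k , k) ≡ false
deleted-diagonal s k = undeleted {s} (λ _ → <⇒≢ (n<1+n k))

deleted-intro : ∀ {s i} → T (special s i) → deleted s (i , suc i) ≡ true
deleted-intro {s} {i} sp = Equivalence.to T-≡ (Equivalence.from T-∧ (sp , ≡⇒≡ᵇ (suc i) (suc i) refl))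

deleted-elim : ∀ {s i j} → deleted s (i , j) ≡ true → T (special s i) × j ≡ suc i
deleted-elim {s} {i} {j} d =
  let sp , j≡ᵇi+1 = Equivalence.to T-∧ (Equivalence.from T-≡ d) in sp , ≡ᵇ⇒≡ j (suc i) j≡ᵇi+1

undeleted⁻¹ : ∀ {s i j} → deleted s (i , j) ≡ false → T (special s i) → j ≢ suc i
undeleted⁻¹ {s} {i} d sp refl = contradiction (trans (sym d) (deleted-intro {s} {i} sp)) λ ()

unspecial-pair : ∀ {s a} → a ≤ s → ¬ T (special s (a ∸ 1)) → ¬ T (special s a) →
  a ≤ 1 ⊎ (isOdd s ≡ false × a ≤ 2)
unspecial-pair {s} {0} _ _ _ = inj₁ z≤n
unspecial-pair {s} {1} _ _ _ = inj₁ ≤-refl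
unspecial-pair {s} {2} 2≤s _ ¬sp₂ with isOdd s ≟ᴮ false
... | yes s-even = inj₂ (s-even , ≤-refl)
... | no s-odd = contradiction (special-intro 2≢s ≤-refl (λ e → contradiction (trans (sym eq) e) λ ())
                                           (≤∧≢⇒< 2≤s λ 2≡s → 2≢s (cong isOdd 2≡s))) ¬sp₂
  where
  eq : isOdd s ≡ true
  eq = ¬-not s-odd
  2≢s : isOdd 2 ≢ isOdd s
  2≢s e = contradiction (trans e eq) λ ()
unspecial-pair {s} {a@(suc (suc (suc a′)))} a≤s ¬sp₁ ¬sp₂ with isOdd a ≟ᴮ isOdd s
... | no a≢s  = contradiction (special-intro a≢s (s≤s (s≤s z≤n)) (λ _ → s≤s (s≤s (s≤s z≤n)))
                                             (≤∧≢⇒< a≤s λ a≡s → a≢s (cong isOdd a≡s))) ¬sp₂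
... | yes a≡s = contradiction (special-intro a-1≢s (s≤s (s≤s z≤n)) 3≤a-1 a≤s) ¬sp₁
  where
  a-1≢s : isOdd (suc (suc a′)) ≢ isOdd s
  a-1≢s e = not-¬ refl (trans e (trans (sym a≡s) (isOdd-suc (suc (suc a′)))))
  3≤a-1 : isOdd s ≡ false → 3 ≤ suc (suc a′)
  3≤a-1 e = ≤∧≢⇒< (s≤s (s≤s z≤n)) λ { refl → contradiction (trans a≡s e) λ () }

-- Hub covers of G_n

module _ (n s : ℕ) where

  -- Hubs are named by pairs; only the hubs of labels actually used need to be vertices.
  data Covered (P : Pair) (e₁ e₂ : ℕ) (W : ℕ → Pair) (Q : Pair) : Set where
    adjacent : AdjPair s Q P → Covered P e₁ e₂ W Q
    via      : ∀ ℓ → ℓ ≢ e₁ → ℓ ≢ e₂ → ℓ ≤ s → IsVertex n s (W ℓ) → W ℓ ≢ P →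
               AdjPair s Q (W ℓ) → AdjPair s (W ℓ) P → Covered P e₁ e₂ W Q

  record PairCover (P : Pair) : Set where
    field
      unused₁ unused₂ : ℕ
      unused₁≢unused₂ : unused₁ ≢ unused₂
      unused₁≤s       : unused₁ ≤ s
      unused₂≤s       : unused₂ ≤ s
      hub             : ℕ → Pair
      covered         : ∀ {Q} → IsVertex n s Q → Covered P unused₁ unused₂ hub Q

  private
    N : ℕ
    N = length (gVerts n s)

    lk : Fin N → Pair
    lk = lookup (gVerts n s)

  -- Pairs that are not vertices are sent to the junk index u.
  position : Fin N → Pair → Fin N
  position u x with x ∈? gVerts n s
  ... | yes x∈ = index x∈
  ... | no _   = u

  lookup-position : ∀ u {x} → IsVertex n s x → lk (position u x) ≡ x
  lookup-position u {x} x-vertex with x ∈? gVerts n s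
  ... | yes x∈ = sym (lookup-index x∈)
  ... | no x∉  = contradiction (IsVertex⇒∈gVerts x-vertex) x∉

  open Rubbling (G n s)

  pairCover⇒hubCover : ∀ u → PairCover (lk u) → HubCover u (suc s)
  pairCover⇒hubCover u C = record
    { hub             = hubᶠ
    ; unused₁         = label unused₁≤s
    ; unused₂         = label unused₂≤s
    ; unused₁≢unused₂ = label-≢ unused₁≤s unused₂≤s unused₁≢unused₂
    ; role            = λ v → proj₁ (classify v)
    ; fits            = λ v → proj₂ (classify v)
    }
    where
    open PairCover C

    hubᶠ : Fin (suc s) → Fin N
    hubᶠ ℓ = position u (hub (toℕ ℓ))

    label : ∀ {ℓ} → ℓ ≤ s → Fin (suc s)
    label ℓ≤s = fromℕ< (s≤s ℓ≤s)

    label-≢ : ∀ {ℓ e} (ℓ≤s : ℓ ≤ s) (e≤s : e ≤ s) → ℓ ≢ e → label ℓ≤s ≢ label e≤s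
    label-≢ ℓ≤s e≤s ℓ≢e eq = ℓ≢e (fromℕ<-injective _ _ (s≤s ℓ≤s) (s≤s e≤s) eq)

    lookup-hub : ∀ {ℓ} (ℓ≤s : ℓ ≤ s) → IsVertex n s (hub ℓ) → lk (hubᶠ (label ℓ≤s)) ≡ hub ℓ
    lookup-hub ℓ≤s hub-vertex rewrite toℕ-fromℕ< (s≤s ℓ≤s) = lookup-position u hub-vertex

    classify : ∀ v → Σ[ r ∈ Role (suc s) ] Fits u hubᶠ (label unused₁≤s) (label unused₂≤s) r v
    classify v with v ≟ u
    ... | yes v≡u = target , v≡u
    ... | no v≢u with covered (vertex v)
    ...   | adjacent v~u = neighbour , v≢u , v~u
    ...   | via ℓ ℓ≢e₁ ℓ≢e₂ ℓ≤s hub-vertex hub≢u v~hub hub~u with v ≟ hubᶠ (label ℓ≤s)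
    ...     | yes v≡hub = neighbour , v≢u ,
                          subst (λ x → AdjPair s x (lk u)) (sym (trans (cong lk v≡hub) (lookup-hub ℓ≤s hub-vertex))) hub~u
    ...     | no v≢hub  = near (label ℓ≤s) , label-≢ ℓ≤s unused₁≤s ℓ≢e₁ , label-≢ ℓ≤s unused₂≤s ℓ≢e₂ ,
                          (v≢hub , subst (AdjPair s (lk v)) (sym (lookup-hub ℓ≤s hub-vertex)) v~hub) ,
                          ((λ eq → hub≢u (trans (sym (lookup-hub ℓ≤s hub-vertex)) (cong lk eq))) ,
                           subst (λ x → AdjPair s x (lk u)) (sym (lookup-hub ℓ≤s hub-vertex)) hub~u)

module Covers (n s : ℕ) (n<h : n < hSize (suc s)) (1≤s : 1 ≤ s) where

  private
    c : ℕ
    c = n ∸ hSize s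

    c≤s : c ≤ s
    c≤s = added-count n<h

    c<s-even : isOdd s ≡ false → c < s
    c<s-even = added-count-even n<h 1≤s

  same-row : ∀ {i j i′ j′} → i ≡ i′ → AdjPair s (i , j) (i′ , j′)
  same-row i≡i′ = inj₁ (inj₁ i≡i′)

  same-col : ∀ {i j i′ j′} → j ≡ j′ → AdjPair s (i , j) (i′ , j′)
  same-col j≡j′ = inj₁ (inj₂ j≡j′)

  extra-up : ∀ {k k′} → T (special s k) → k′ ≡ suc k → AdjPair s (k , k) (k′ , k′)
  extra-up sp refl = inj₂ (inj₁ (sp , refl , refl , refl))

  extra-down : ∀ {k k′} → T (special s k) → k′ ≡ suc k → AdjPair s (k′ , k′) (k , k)
  extra-down sp refl = inj₂ (inj₂ (sp , refl , refl , refl))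

  row-≢ : ∀ {i j i′ j′ : ℕ} → i ≢ i′ → (i , j) ≢ (i′ , j′)
  row-≢ i≢i′ eq = i≢i′ (cong proj₁ eq)

  col-≢ : ∀ {i j i′ j′ : ℕ} → j ≢ j′ → (i , j) ≢ (i′ , j′)
  col-≢ j≢j′ eq = j≢j′ (cong proj₂ eq)

  via-hub : ∀ {P e₁ e₂ W Q} ℓ {X} → W ℓ ≡ X → ℓ ≢ e₁ → ℓ ≢ e₂ → ℓ ≤ s → IsVertex n s X → X ≢ P →
            AdjPair s Q X → AdjPair s X P → Covered n s P e₁ e₂ W Q
  via-hub ℓ refl = via ℓ

  added-above : ∀ {j j′} → s < j + c → j ≤ j′ → j′ ≤ s → IsVertex n s (0 , j′)
  added-above s<j+c j≤j′ j′≤s = added j′≤s (<-≤-trans s<j+c (+-monoˡ-≤ c j≤j′))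

  added-positive : ∀ {j} → s < j + c → 0 < j
  added-positive {zero}  s<c = contradiction (<-≤-trans s<c c≤s) (<-irrefl refl)
  added-positive {suc j} _   = s≤s z≤n

  hub-added : ℕ → ℕ → Pair
  hub-added b ℓ = if ℓ <ᵇ b then (if deleted s (ℓ , b) then (b , b) else (ℓ , b)) else (0 , ℓ)

  hub-added-col : ∀ {b ℓ} → ℓ < b → deleted s (ℓ , b) ≡ false → hub-added b ℓ ≡ (ℓ , b)
  hub-added-col {b} {ℓ} ℓ<b d rewrite <ᵇ-true ℓ<b | d = refl

  hub-added-diagonal : ∀ {b ℓ} → ℓ < b → deleted s (ℓ , b) ≡ true → hub-added b ℓ ≡ (b , b)
  hub-added-diagonal {b} {ℓ} ℓ<b d rewrite <ᵇ-true ℓ<b | d = refl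

  hub-added-row : ∀ {b ℓ} → ¬ ℓ < b → hub-added b ℓ ≡ (0 , ℓ)
  hub-added-row {b} {ℓ} ℓ≮b rewrite <ᵇ-false ℓ≮b = refl

  cover-added : ∀ {b} → IsVertex n s (0 , b) → PairCover n s (0 , b)
  cover-added {b} (added b≤s s<b+c) = record
    { unused₁ = 0 ; unused₂ = b ; unused₁≢unused₂ = <⇒≢ (added-positive s<b+c)
    ; unused₁≤s = z≤n ; unused₂≤s = b≤s ; hub = hub-added b ; covered = covered }
    where
    row-hub : ∀ {i j} → b < j → j ≤ s → Covered n s (0 , b) 0 b (hub-added b) (i , j)
    row-hub {j = j} b<j j≤s =
      via-hub j (hub-added-row (<⇒≯ b<j))
        (>⇒≢ (≤-<-trans z≤n b<j)) (>⇒≢ b<j) j≤s (added-above s<b+c (<⇒≤ b<j) j≤s) (col-≢ (>⇒≢ b<j))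
        (same-col refl) (same-row refl)
    covered : ∀ {Q} → IsVertex n s Q → Covered n s (0 , b) 0 b (hub-added b) Q
    covered (added _ _) = adjacent (same-row refl)
    covered (kept {i} {j} 1≤i i≤j j≤s undel) with j ≟ℕ b | i <? b
    ... | yes j≡b | _      = adjacent (same-col j≡b)
    ... | no j≢b  | no i≮b = row-hub (≤∧≢⇒< (≤-trans (≮⇒≥ i≮b) i≤j) (≢-sym j≢b)) j≤s
    ... | no j≢b  | yes i<b with deleted s (i , b) in del
    ...   | false = via-hub i (hub-added-col i<b del)
                      (>⇒≢ 1≤i) (<⇒≢ i<b) (≤-trans i≤j j≤s) (kept 1≤i (<⇒≤ i<b) b≤s del) (row-≢ (>⇒≢ 1≤i))
                      (same-row refl) (same-col refl)
    ...   | true with deleted-elim {s} {i} {b} del | j ≟ℕ i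
    ...     | sp , refl | yes refl = via-hub i (hub-added-diagonal i<b del) (>⇒≢ 1≤i) (<⇒≢ i<b) j≤s
                                       (kept (≤-trans 1≤i (<⇒≤ i<b)) ≤-refl b≤s (deleted-diagonal s b))
                                       (row-≢ (>⇒≢ (≤-trans 1≤i (<⇒≤ i<b))))
                                       (extra-up sp refl) (same-col refl)
    ...     | _ , refl | no j≢i = row-hub (≤∧≢⇒< (≤∧≢⇒< i≤j (≢-sym j≢i)) (≢-sym j≢b)) j≤s

  hub-upper : ℕ → ℕ → ℕ → Pair
  hub-upper a b ℓ = if ℓ <ᵇ a then (ℓ , b) else (if deleted s (a , ℓ) then (suc a , b) else (a , ℓ))

  hub-upper-col : ∀ {a b ℓ} → ℓ < a → hub-upper a b ℓ ≡ (ℓ , b)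
  hub-upper-col ℓ<a rewrite <ᵇ-true ℓ<a = refl

  hub-upper-row : ∀ {a b ℓ} → ¬ ℓ < a → deleted s (a , ℓ) ≡ false → hub-upper a b ℓ ≡ (a , ℓ)
  hub-upper-row ℓ≮a d rewrite <ᵇ-false ℓ≮a | d = refl

  hub-upper-shifted : ∀ {a b ℓ} → ¬ ℓ < a → deleted s (a , ℓ) ≡ true → hub-upper a b ℓ ≡ (suc a , b)
  hub-upper-shifted ℓ≮a d rewrite <ᵇ-false ℓ≮a | d = refl

  cover-upper : ∀ {a b} → 1 ≤ a → a < b → b ≤ s → deleted s (a , b) ≡ false → PairCover n s (a , b)
  cover-upper {a} {b} 1≤a a<b b≤s undel-ab = record
    { unused₁ = a ; unused₂ = b ; unused₁≢unused₂ = <⇒≢ a<b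
    ; unused₁≤s = <⇒≤ (<-≤-trans a<b b≤s) ; unused₂≤s = b≤s ; hub = hub-upper a b ; covered = covered }
    where
    row-hub : ∀ {i j} → a < j → j ≢ b → j ≤ s → deleted s (a , j) ≡ false →
              Covered n s (a , b) a b (hub-upper a b) (i , j)
    row-hub a<j j≢b j≤s undel =
      via-hub _ (hub-upper-row (<⇒≯ a<j) undel) (>⇒≢ a<j) j≢b j≤s (kept 1≤a (<⇒≤ a<j) j≤s undel) (col-≢ j≢b)
        (same-col refl) (same-row refl)
    covered : ∀ {Q} → IsVertex n s Q → Covered n s (a , b) a b (hub-upper a b) Q
    covered (added {j} j≤s s<j+c) with j ≟ℕ b | s <? b + c
    ... | yes j≡b | _ = adjacent (same-col j≡b)
    ... | no j≢b | yes s<b+c =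
      via-hub 0 (hub-upper-col 1≤a) (<⇒≢ 1≤a) (<⇒≢ (<-trans 1≤a a<b)) z≤n (added b≤s s<b+c) (row-≢ (<⇒≢ 1≤a))
        (same-row refl) (same-col refl)
    ... | no j≢b | no s≮b+c =
      row-hub (<-trans a<b b<j) j≢b j≤s (undeleted {s} {a} (λ _ → >⇒≢ (≤-trans (s≤s a<b) b<j)))
      where
      b<j : b < j
      b<j = ≰⇒> λ j≤b → s≮b+c (<-≤-trans s<j+c (+-monoˡ-≤ c j≤b))
    covered (kept {i} {j} 1≤i i≤j j≤s undel) with i ≟ℕ a | j ≟ℕ b | i <? a
    ... | yes i≡a | _       | _   = adjacent (same-row i≡a)
    ... | no _    | yes j≡b | _   = adjacent (same-col j≡b)
    ... | no i≢a  | no j≢b  | yes i<a =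
      via-hub i (hub-upper-col i<a) i≢a (<⇒≢ (<-trans i<a a<b)) (≤-trans i≤j j≤s)
        (kept 1≤i (<⇒≤ (<-trans i<a a<b)) b≤s (undeleted {s} {i} (λ _ → >⇒≢ (≤-trans (s≤s i<a) a<b))))
        (row-≢ i≢a)
        (same-row refl) (same-col refl)
    ... | no i≢a  | no j≢b  | no i≮a with deleted s (a , j) in del
    ...   | false = row-hub (<-≤-trans a<i i≤j) j≢b j≤s del
      where
      a<i : a < i
      a<i = ≤∧≢⇒< (≮⇒≥ i≮a) (≢-sym i≢a)
    ...   | true with deleted-elim {s} {a} {j} del
    ...     | sp , refl =
      via-hub (suc a) (hub-upper-shifted (<⇒≯ (n<1+n a)) del) (>⇒≢ (n<1+n a))
        (≢-sym (undeleted⁻¹ {s} {a} undel-ab sp)) j≤s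
        (kept (s≤s z≤n) a<b b≤s (undeleted {s} {suc a} {b} λ sp′ → contradiction sp′ (special-not-consecutive {s} {a} sp)))
        (row-≢ (>⇒≢ (n<1+n a))) (same-row (≤-antisym i≤j (≤∧≢⇒< (≮⇒≥ i≮a) (≢-sym i≢a))))
        (same-col refl)

  hub-diagonal : ℕ → ℕ → Pair
  hub-diagonal a ℓ = if ℓ <ᵇ a then (ℓ , a) else (if deleted s (a , ℓ) then (suc a , suc a) else (a , ℓ))

  hub-diagonal-col : ∀ {a ℓ} → ℓ < a → hub-diagonal a ℓ ≡ (ℓ , a)
  hub-diagonal-col ℓ<a rewrite <ᵇ-true ℓ<a = refl

  hub-diagonal-row : ∀ {a ℓ} → ¬ ℓ < a → deleted s (a , ℓ) ≡ false → hub-diagonal a ℓ ≡ (a , ℓ)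
  hub-diagonal-row ℓ≮a d rewrite <ᵇ-false ℓ≮a | d = refl

  hub-diagonal-next : ∀ {a ℓ} → ¬ ℓ < a → deleted s (a , ℓ) ≡ true → hub-diagonal a ℓ ≡ (suc a , suc a)
  hub-diagonal-next ℓ≮a d rewrite <ᵇ-false ℓ≮a | d = refl

  -- The second unused label for the target (a , a). In the last case no added vertex (0 , j)
  -- has j < a (by unspecial-pair and the bounds on c), so label 0 needs no hub.
  data SecondUnused (a : ℕ) : ℕ → Set where
    below : T (special s (a ∸ 1)) → SecondUnused a (a ∸ 1)
    above : ¬ T (special s (a ∸ 1)) → T (special s a) → s < a + c → SecondUnused a (suc a)
    first : ¬ T (special s (a ∸ 1)) → (T (special s a) → ¬ s < a + c) → SecondUnused a 0

  secondUnused : ∀ a → Σ ℕ (SecondUnused a)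
  secondUnused a with T? (special s (a ∸ 1)) | T? (special s a) | s <? a + c
  ... | yes sp₋ | _      | _         = a ∸ 1 , below sp₋
  ... | no ¬sp₋ | yes sp | yes s<a+c = suc a , above ¬sp₋ sp s<a+c
  ... | no ¬sp₋ | yes sp | no s≮a+c  = 0 , first ¬sp₋ (λ _ → s≮a+c)
  ... | no ¬sp₋ | no ¬sp | _         = 0 , first ¬sp₋ (λ sp → contradiction sp ¬sp)

  added-beyond-one : ∀ {j} → isOdd s ≡ false → s < j + c → 1 < j
  added-beyond-one {0}           _    s<c   = contradiction (<-≤-trans s<c c≤s) (<-irrefl refl)
  added-beyond-one {1}           s-even s<1+c = contradiction (<-≤-trans s<1+c (c<s-even s-even)) (<-irrefl refl)
  added-beyond-one {suc (suc j)} _    _     = s≤s (s≤s z≤n)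

  cover-diagonal : ∀ {a} → 1 ≤ a → a ≤ s → PairCover n s (a , a)
  cover-diagonal {a@(suc a₋)} (s≤s z≤n) a≤s with secondUnused a
  ... | e , view = record
    { unused₁ = a ; unused₂ = e ; unused₁≢unused₂ = a≢e view
    ; unused₁≤s = a≤s ; unused₂≤s = e≤s view ; hub = hub-diagonal a ; covered = covered }
    where
    a≢e : ∀ {e} → SecondUnused a e → a ≢ e
    a≢e (below _)     = >⇒≢ (n<1+n a₋)
    a≢e (above _ _ _) = <⇒≢ (n<1+n a)
    a≢e (first _ _)   = λ ()

    e≤s : ∀ {e} → SecondUnused a e → e ≤ s
    e≤s (below _)      = ≤-trans (n≤1+n a₋) a≤s
    e≤s (above _ sp _) = proj₂ (proj₂ (special-elim {s} {a} sp))
    e≤s (first _ _)    = z≤n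

    col-label-ok : ∀ {i e} → SecondUnused a e → 1 ≤ i → i < a → deleted s (i , a) ≡ false → i ≢ e
    col-label-ok (below sp₋)   _   _   undel refl = undeleted⁻¹ {s} {a₋} undel sp₋ refl
    col-label-ok (above _ _ _) _   i<a _     = <⇒≢ (<-trans i<a (n<1+n a))
    col-label-ok (first _ _)   1≤i _   _     = >⇒≢ 1≤i

    row-label-ok : ∀ {j e} → SecondUnused a e → a < j → deleted s (a , j) ≡ false → j ≢ e
    row-label-ok (below _)      a<j _     = >⇒≢ (<-trans (n<1+n a₋) a<j)
    row-label-ok (above _ sp _) _   undel = undeleted⁻¹ {s} {a} undel sp
    row-label-ok (first _ _)    a<j _     = >⇒≢ (≤-trans (s≤s z≤n) a<j)

    zero-label-ok : ∀ {j e} → SecondUnused a e → j < a → s < j + c → 0 ≢ e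
    zero-label-ok (below sp₋)     _   _      = <⇒≢ (≤-trans (s≤s z≤n) (proj₁ (proj₂ (special-elim {s} {a₋} sp₋))))
    zero-label-ok (above _ _ _)   _   _      = λ ()
    zero-label-ok (first ¬sp₋ ¬a) j<a s<j+c _ with T? (special s a)
    ... | yes sp = ¬a sp (<-≤-trans s<j+c (+-monoˡ-≤ c (<⇒≤ j<a)))
    ... | no ¬sp with unspecial-pair {s} {a} a≤s ¬sp₋ ¬sp
    ...   | inj₁ a≤1          = <-irrefl refl (<-≤-trans (added-positive s<j+c) (s≤s⁻¹ (≤-trans j<a a≤1)))
    ...   | inj₂ (s-even , a≤2) = <-irrefl refl (<-≤-trans (added-beyond-one s-even s<j+c) (s≤s⁻¹ (≤-trans j<a a≤2)))

    zero-label-ok-special : ∀ {e} → SecondUnused a e → T (special s a) → s < a + c → 0 ≢ e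
    zero-label-ok-special (below sp₋)   sp _      = contradiction sp (special-not-consecutive {s} {a₋} sp₋)
    zero-label-ok-special (above _ _ _) _  _      = λ ()
    zero-label-ok-special (first _ ¬a)  sp s<a+c  = contradiction s<a+c (¬a sp)

    diagonal-label-ok : ∀ {e} → SecondUnused a e → T (special s a) → ¬ s < a + c → suc a ≢ e
    diagonal-label-ok (below sp₋)         sp _       = contradiction sp (special-not-consecutive {s} {a₋} sp₋)
    diagonal-label-ok (above _ _ s<a+c)   _  s≮a+c   = contradiction s<a+c s≮a+c
    diagonal-label-ok (first _ _)         _  _       = λ ()

    Covered′ : Pair → Set
    Covered′ = Covered n s (a , a) a e (hub-diagonal a)

    col-hub : ∀ {i j} → 1 ≤ i → i < a → deleted s (i , a) ≡ false → Covered′ (i , j)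
    col-hub 1≤i i<a undel =
      via-hub _ (hub-diagonal-col i<a) (<⇒≢ i<a) (col-label-ok view 1≤i i<a undel) (≤-trans (<⇒≤ i<a) a≤s)
        (kept 1≤i (<⇒≤ i<a) a≤s undel) (row-≢ (<⇒≢ i<a)) (same-row refl) (same-col refl)

    row-hub : ∀ {i j} → a < j → j ≤ s → deleted s (a , j) ≡ false → Covered′ (i , j)
    row-hub a<j j≤s undel =
      via-hub _ (hub-diagonal-row (<⇒≯ a<j) undel) (>⇒≢ a<j) (row-label-ok view a<j undel) j≤s
        (kept (s≤s z≤n) (<⇒≤ a<j) j≤s undel) (col-≢ (>⇒≢ a<j)) (same-col refl) (same-row refl)

    added-hub : ∀ {j} → s < a + c → 0 ≢ e → Covered′ (0 , j)
    added-hub s<a+c 0≢e =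
      via-hub 0 (hub-diagonal-col (s≤s z≤n)) (λ ()) 0≢e z≤n (added a≤s s<a+c) (row-≢ λ ()) (same-row refl) (same-col refl)

    covered : ∀ {Q} → IsVertex n s Q → Covered′ Q
    covered (added {j} j≤s s<j+c) with j ≟ℕ a | j <? a
    ... | yes j≡a | _     = adjacent (same-col j≡a)
    ... | no _    | yes j<a = added-hub (<-≤-trans s<j+c (+-monoˡ-≤ c (<⇒≤ j<a))) (zero-label-ok view j<a s<j+c)
    ... | no j≢a  | no j≮a with deleted s (a , j) in del
    ...   | false = row-hub (≤∧≢⇒< (≮⇒≥ j≮a) (≢-sym j≢a)) j≤s del
    ...   | true with deleted-elim {s} {a} {j} del | s <? a + c
    ...     | sp , refl | yes s<a+c = added-hub s<a+c (zero-label-ok-special view sp s<a+c)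
    ...     | sp , refl | no s≮a+c  =
      via-hub (suc a) (hub-diagonal-next (<⇒≯ (n<1+n a)) del) (>⇒≢ (n<1+n a)) (diagonal-label-ok view sp s≮a+c) j≤s
        (kept (s≤s z≤n) ≤-refl j≤s (deleted-diagonal s (suc a))) (row-≢ λ ()) (same-col refl) (extra-down sp refl)
    covered (kept {i} {j} 1≤i i≤j j≤s undel) with i ≟ℕ a | j ≟ℕ a | j <? a
    ... | yes i≡a | _       | _       = adjacent (same-row i≡a)
    ... | no _    | yes j≡a | _       = adjacent (same-col j≡a)
    ... | no i≢a  | no j≢a  | yes j<a with deleted s (i , a) in del
    ...   | false = col-hub 1≤i (≤-<-trans i≤j j<a) del
    ...   | true with deleted-elim {s} {i} {a} del
    ...     | sp , refl =
      adjacent (subst (λ k → AdjPair s (i , k) (a , a)) (≤-antisym i≤j (s≤s⁻¹ j<a)) (extra-up sp refl))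
    covered (kept {i} {j} 1≤i i≤j j≤s undel) | no i≢a | no j≢a | no j≮a with deleted s (a , j) in del
    ... | false = row-hub (≤∧≢⇒< (≮⇒≥ j≮a) (≢-sym j≢a)) j≤s del
    ... | true with deleted-elim {s} {a} {j} del | i ≟ℕ suc a
    ...   | sp , refl | yes refl = adjacent (extra-down sp refl)
    ...   | sp , refl | no i≢a+1 = col-hub 1≤i i<a (undeleted {s} {i} {a} λ spᵢ a≡i+1 →
                                     special-not-consecutive {s} {i} spᵢ (subst (T ∘ special s) a≡i+1 sp))
      where
      i<a : i < a
      i<a = ≤∧≢⇒< (s≤s⁻¹ (≤∧≢⇒< i≤j i≢a+1)) i≢a

  pairCover : ∀ {P} → IsVertex n s P → PairCover n s P
  pairCover v@(added _ _)              = cover-added v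
  pairCover (kept 1≤i i≤j j≤s undel) with m≤n⇒m<n∨m≡n i≤j
  ... | inj₁ i<j  = cover-upper 1≤i i<j j≤s undel
  ... | inj₂ refl = cover-diagonal 1≤i j≤s

n<hSize[1+s]⇒1≤s : ∀ {n s} → 1 ≤ n → n < hSize (suc s) → 1 ≤ s
n<hSize[1+s]⇒1≤s {s = zero}  1≤n n<1 = contradiction (<-≤-trans n<1 1≤n) (<-irrefl refl)
n<hSize[1+s]⇒1≤s {s = suc _} _   _   = s≤s z≤n

hSize≤n⇒s≤r : ∀ {n s r} → 1 ≤ s → hSize s ≤ n → 2 * n ∸ 1 < suc r * suc r → s ≤ r
hSize≤n⇒s≤r {n} {s} {r} 1≤s h≤n 2n-1<[r+1]² with s ≤? r
... | yes s≤r = s≤r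
... | no s≰r  = contradiction (begin-strict
  suc r * suc r     ≤⟨ *-mono-≤ (≰⇒> s≰r) (≰⇒> s≰r) ⟩
  s * s             ≤⟨ suc[m]≤n⇒m≤pred[n] (<-≤-trans (square<2*hSize s 1≤s) (*-monoʳ-≤ 2 h≤n)) ⟩
  2 * n ∸ 1         <⟨ 2n-1<[r+1]² ⟩
  suc r * suc r     ∎) (<-irrefl refl)
  where open ≤-Reasoning

mainTheorem2 : (n s r : ℕ) → 3 ≤ n →
    hSize s ≤ n → n < hSize (suc s) →
    r * r ≤ 2 * n ∸ 1 → 2 * n ∸ 1 < suc r * suc r →
    RubblingNumber≤ (G n s) (r + 2)
mainTheorem2 n s r 3≤n h≤n n<h _ 2n-1<[r+1]² = r + 2 , ≤-refl , hubCovers⇒solvable cover s+2≤r+2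
  where
  open Rubbling (G n s)
  1≤s : 1 ≤ s
  1≤s = n<hSize[1+s]⇒1≤s (≤-trans (s≤s z≤n) 3≤n) n<h
  open Covers n s n<h 1≤s
  cover : ∀ u → HubCover u (suc s)
  cover u = pairCover⇒hubCover n s u (pairCover (vertex u))
  s+2≤r+2 : suc (suc s) ≤ r + 2
  s+2≤r+2 = ≤-trans (s≤s (s≤s (hSize≤n⇒s≤r 1≤s h≤n 2n-1<[r+1]²))) (≤-reflexive (+-comm 2 r))
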